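{- Let $G$ be a connected $P_5$-free chordal bipartite graph with bipartition $(A,B)$, let $(A_1,B_1)$ be a maximum biclique of $G$ with $A_1\subseteq A$, $B_1\subseteq B$, and let $A_2=A\setminus A_1$, $B_2=B\setminus B_1$. Then for every $x\in A_2$ we have $N_G(x)\subsetneq B_1$, and for every $y\in B_2$ we have $N_G(y)\subsetneq A_1$.
   Context: Graphs are finite, simple and undirected. A bipartite graph is chordal bipartite if every cycle of length at least six has a chord. $G$ is $P_5$-free if it has no induced path on five vertices. $N_G(v)$ is the set of neighbours of $v$. A biclique is a pair $(X,Y)$ with $X\subseteq A$, $Y\subseteq B$ such that every vertex of $X$ is adjacent to every vertex of $Y$; it is maximal if no vertex of $A\setminus X$ can be added to $X$ and no vertex of $B\setminus Y$ can be added to $Y$ keeping this property. Following the paper, a maximum biclique is a maximal biclique $(X,Y)$ for which $\bigl||X|-|Y|\bigr|$ is minimum. -}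

module Defs where

open import Data.Nat using (ℕ; suc; _≤_; ∣_-_∣)
open import Data.Fin using (Fin; toℕ)
open import Data.Fin.Subset using (Subset; _∈_; _∉_; ∣_∣)
open import Data.Bool using (Bool; true; false)
open import Data.Sum using (_⊎_; inj₁; inj₂)
open import Data.Product using (Σ; ∃; _×_; _,_)
open import Relation.Nullary using (¬_)
open import Relation.Binary.PropositionalEquality using (_≡_; _≢_)
open import Relation.Binary.Construct.Closure.ReflexiveTransitive using (Star)

-- A finite simple bipartite graph with bipartition (A , B), A = Fin m, B = Fin n,
-- given by its biadjacency matrix.  Edges only go between A and B.
record BipGraph : Set where
  field
    m n : ℕ
    E   : Fin m → Fin n → Bool

module _ (G : BipGraph) where
  open BipGraph G

  V : Set
  V = Fin m ⊎ Fin n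

  Adj : V → V → Set
  Adj (inj₁ a) (inj₁ a') = Data.Empty.⊥ where import Data.Empty
  Adj (inj₁ a) (inj₂ b)  = E a b ≡ true
  Adj (inj₂ b) (inj₁ a)  = E a b ≡ true
  Adj (inj₂ b) (inj₂ b') = Data.Empty.⊥ where import Data.Empty

  Connected : Set
  Connected = (u v : V) → Star Adj u v

  InducedP5 : V → V → V → V → V → Set
  InducedP5 v0 v1 v2 v3 v4 =
    v0 ≢ v1 × v0 ≢ v2 × v0 ≢ v3 × v0 ≢ v4 × v1 ≢ v2 × v1 ≢ v3 × v1 ≢ v4 ×
    v2 ≢ v3 × v2 ≢ v4 × v3 ≢ v4 ×
    Adj v0 v1 × Adj v1 v2 × Adj v2 v3 × Adj v3 v4 ×
    ¬ Adj v0 v2 × ¬ Adj v0 v3 × ¬ Adj v0 v4 × ¬ Adj v1 v3 × ¬ Adj v1 v4 × ¬ Adj v2 v4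

  P5Free : Set
  P5Free = ∀ v0 v1 v2 v3 v4 → ¬ InducedP5 v0 v1 v2 v3 v4

  Consec : (k : ℕ) → Fin k → Fin k → Set
  Consec k i j = suc (toℕ i) ≡ toℕ j ⊎ (suc (toℕ i) ≡ k × toℕ j ≡ 0)

  IsCycle : (k : ℕ) → (Fin k → V) → Set
  IsCycle k c = (∀ i j → c i ≡ c j → i ≡ j) × (∀ i j → Consec k i j → Adj (c i) (c j))

  HasChord : (k : ℕ) → (Fin k → V) → Set
  HasChord k c = ∃ λ i → ∃ λ j → Adj (c i) (c j) × ¬ Consec k i j × ¬ Consec k j i

  -- chordal bipartite (G is bipartite by construction)
  ChordalBipartite : Set
  ChordalBipartite = ∀ k (c : Fin k → V) → 6 ≤ k → IsCycle k c → HasChord k c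

  IsBiclique : Subset m → Subset n → Set
  IsBiclique X Y = ∀ a b → a ∈ X → b ∈ Y → E a b ≡ true

  IsMaximalBiclique : Subset m → Subset n → Set
  IsMaximalBiclique X Y =
    IsBiclique X Y ×
    (∀ a → a ∉ X → ¬ (∀ b → b ∈ Y → E a b ≡ true)) ×
    (∀ b → b ∉ Y → ¬ (∀ a → a ∈ X → E a b ≡ true))

  -- maximum biclique (in the sense of the paper): a maximal biclique minimising ||X| - |Y||
  IsMaximumBiclique : Subset m → Subset n → Set
  IsMaximumBiclique X Y =
    IsMaximalBiclique X Y ×
    (∀ X' Y' → IsMaximalBiclique X' Y' → ∣ ∣ X ∣ - ∣ Y ∣ ∣ ≤ ∣ ∣ X' ∣ - ∣ Y' ∣ ∣)

-- Maximality of (A₁ , B₁) gives every x ∉ A₁ a non-neighbour b₀ ∈ B₁ and every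
-- y ∉ B₁ a non-neighbour a₀ ∈ A₁.  An edge x y would then form, with the edge a₀ b₀
-- of the biclique, an induced 2K₂; but in a connected bipartite graph, walking
-- along a path from one edge of an induced 2K₂ to the other always produces an
-- induced P₅.
module Submission where

open import Defs
open import Data.Fin using (Fin)
open import Data.Fin.Subset using (Subset; _∈_; _∉_)
open import Data.Fin.Subset.Properties using (_∈?_)
open import Data.Fin.Properties using (¬∀⟶∃¬)
open import Data.Bool using (true; false)
open import Data.Bool.Properties using (_≟_; ¬-not; not-¬)
open import Data.Empty using (⊥; ⊥-elim)
open import Data.Product using (∃; _×_; _,_; proj₁; proj₂)
open import Data.Sum using (inj₁; inj₂)
open import Relation.Nullary using (¬_; yes; no)
open import Relation.Nullary.Decidable using (_→-dec_; decidable-stable)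
open import Relation.Unary using (Pred; Decidable)
open import Relation.Binary.PropositionalEquality using (_≡_; refl; _≢_; ≢-sym)
open import Relation.Binary.Construct.Closure.ReflexiveTransitive using (Star; ε; _◅_)

¬∀∈⟶∃∈¬ : ∀ {n p} (S : Subset n) (P : Pred (Fin n) p) → Decidable P →
          ¬ (∀ i → i ∈ S → P i) → ∃ λ i → i ∈ S × ¬ P i
¬∀∈⟶∃∈¬ {n} S P P? ¬∀ with ¬∀⟶∃¬ n (λ i → i ∈ S → P i) (λ i → (i ∈? S) →-dec P? i) ¬∀
... | i , ¬[i∈S→Pi] =
  i , decidable-stable (i ∈? S) (λ i∉S → ¬[i∈S→Pi] (λ i∈S → ⊥-elim (i∉S i∈S)))
    , (λ Pi → ¬[i∈S→Pi] (λ _ → Pi))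

module _ (G : BipGraph) where
  open BipGraph G

  infix 4 _—_
  _—_ : Fin m → Fin n → Set
  a — b = E a b ≡ true

  separatedˡ : ∀ {a a' b} → a — b → ¬ a' — b → _≢_ {A = V G} (inj₁ a) (inj₁ a')
  separatedˡ ab ¬a'b refl = ¬a'b ab

  separatedʳ : ∀ {a b b'} → a — b → ¬ a — b' → _≢_ {A = V G} (inj₂ b) (inj₂ b')
  separatedʳ ab ¬ab' refl = ¬ab' ab

  induced-P5-BABAB : ∀ {b₀ b₁ b₂ a₁ a₂} →
    a₁ — b₀ → a₁ — b₁ → a₂ — b₁ → a₂ — b₂ → ¬ a₂ — b₀ → ¬ a₁ — b₂ →
    InducedP5 G (inj₂ b₀) (inj₁ a₁) (inj₂ b₁) (inj₁ a₂) (inj₂ b₂)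
  induced-P5-BABAB a₁b₀ a₁b₁ a₂b₁ a₂b₂ ¬a₂b₀ ¬a₁b₂ =
    (λ ()) , ≢-sym (separatedʳ a₂b₁ ¬a₂b₀) , (λ ()) , separatedʳ a₁b₀ ¬a₁b₂
    , (λ ()) , separatedˡ a₁b₀ ¬a₂b₀ , (λ ())
    , (λ ()) , separatedʳ a₁b₁ ¬a₁b₂
    , (λ ())
    , a₁b₀ , a₁b₁ , a₂b₁ , a₂b₂
    , (λ ()) , ¬a₂b₀ , (λ ()) , (λ ()) , ¬a₁b₂ , (λ ())

  induced-P5-ABABA : ∀ {a₀ a₂ a₄ b₁ b₃} →
    a₀ — b₁ → a₂ — b₁ → a₂ — b₃ → a₄ — b₃ → ¬ a₀ — b₃ → ¬ a₄ — b₁ →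
    InducedP5 G (inj₁ a₀) (inj₂ b₁) (inj₁ a₂) (inj₂ b₃) (inj₁ a₄)
  induced-P5-ABABA a₀b₁ a₂b₁ a₂b₃ a₄b₃ ¬a₀b₃ ¬a₄b₁ =
    (λ ()) , ≢-sym (separatedˡ a₂b₃ ¬a₀b₃) , (λ ()) , ≢-sym (separatedˡ a₄b₃ ¬a₀b₃)
    , (λ ()) , separatedʳ a₀b₁ ¬a₀b₃ , (λ ())
    , (λ ()) , separatedˡ a₂b₁ ¬a₄b₁
    , (λ ())
    , a₀b₁ , a₂b₁ , a₂b₃ , a₄b₃
    , (λ ()) , ¬a₀b₃ , (λ ()) , (λ ()) , ¬a₄b₁ , (λ ())

  -- Induction on a path x = u₀ u₁ u₂ … a: either y x u₁ a b or x u₁ u₂ b a is an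
  -- induced P₅, or u₂ u₁ , a b is an induced 2K₂ whose path to a is shorter.
  P5-free⇒no-connected-2K2 : P5Free G → ∀ {x a y b} → Star (Adj G) (inj₁ x) (inj₁ a) →
    x — y → a — b → ¬ x — b → ¬ a — y → ⊥
  P5-free⇒no-connected-2K2 p5 ε xy _ _ ¬ay = ¬ay xy
  P5-free⇒no-connected-2K2 p5 (_◅_ {j = inj₁ _} () _)
  P5-free⇒no-connected-2K2 p5 (_◅_ {j = inj₂ _} _ (_◅_ {j = inj₂ _} () _))
  P5-free⇒no-connected-2K2 p5 {a = a} {b = b}
    (_◅_ {j = inj₂ u₁} xu₁ (_◅_ {j = inj₁ u₂} u₂u₁ path)) xy ab ¬xb ¬ay
    with E a u₁ ≟ true | E u₂ b ≟ true
  ... | yes au₁ | _ =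
    p5 _ _ _ _ _ (induced-P5-BABAB xy xu₁ au₁ ab ¬ay ¬xb)
  ... | no ¬au₁ | yes u₂b =
    p5 _ _ _ _ _ (induced-P5-ABABA xu₁ u₂u₁ u₂b ab ¬xb ¬au₁)
  ... | no ¬au₁ | no ¬u₂b =
    P5-free⇒no-connected-2K2 p5 path u₂u₁ ab ¬u₂b ¬au₁

  module _ {X : Subset m} {Y : Subset n} (maximal : IsMaximalBiclique G X Y) where

    ∉ˡ⇒∃-non-neighbour : ∀ {a} → a ∉ X → ∃ λ b → b ∈ Y × E a b ≡ false
    ∉ˡ⇒∃-non-neighbour {a} a∉X
      with ¬∀∈⟶∃∈¬ Y (a —_) (λ b → E a b ≟ true) (proj₁ (proj₂ maximal) a a∉X)
    ... | b , b∈Y , ¬ab = b , b∈Y , ¬-not ¬ab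

    ∉ʳ⇒∃-non-neighbour : ∀ {b} → b ∉ Y → ∃ λ a → a ∈ X × E a b ≡ false
    ∉ʳ⇒∃-non-neighbour {b} b∉Y
      with ¬∀∈⟶∃∈¬ X (_— b) (λ a → E a b ≟ true) (proj₂ (proj₂ maximal) b b∉Y)
    ... | a , a∈X , ¬ab = a , a∈X , ¬-not ¬ab

    module _ (connected : Connected G) (p5-free : P5Free G) where

      ∉ˡ-∉ʳ-nonadjacent : ∀ {x y} → x ∉ X → y ∉ Y → ¬ x — y
      ∉ˡ-∉ʳ-nonadjacent {x} x∉X y∉Y xy
        with ∉ˡ⇒∃-non-neighbour x∉X | ∉ʳ⇒∃-non-neighbour y∉Y
      ... | b₀ , b₀∈Y , xb₀≡false | a₀ , a₀∈X , a₀y≡false =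
        P5-free⇒no-connected-2K2 p5-free (connected (inj₁ x) (inj₁ a₀))
          xy (proj₁ maximal a₀ b₀ a₀∈X b₀∈Y) (not-¬ xb₀≡false) (not-¬ a₀y≡false)

      ∉ˡ⇒neighbours⊆ʳ : ∀ {x} → x ∉ X → ∀ b → x — b → b ∈ Y
      ∉ˡ⇒neighbours⊆ʳ x∉X b xb =
        decidable-stable (b ∈? Y) (λ b∉Y → ∉ˡ-∉ʳ-nonadjacent x∉X b∉Y xb)

      ∉ʳ⇒neighbours⊆ˡ : ∀ {y} → y ∉ Y → ∀ a → a — y → a ∈ X
      ∉ʳ⇒neighbours⊆ˡ y∉Y a ay =
        decidable-stable (a ∈? X) (λ a∉X → ∉ˡ-∉ʳ-nonadjacent a∉X y∉Y ay)

lemma2 : (G : BipGraph) → Connected G → P5Free G → ChordalBipartite G →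
    (A₁ : Subset (BipGraph.m G)) (B₁ : Subset (BipGraph.n G)) →
    IsMaximumBiclique G A₁ B₁ →
    ((x : _) → x ∉ A₁ →
      (∀ b → BipGraph.E G x b ≡ true → b ∈ B₁) × (∃ λ b → b ∈ B₁ × BipGraph.E G x b ≡ false)) ×
    ((y : _) → y ∉ B₁ →
      (∀ a → BipGraph.E G a y ≡ true → a ∈ A₁) × (∃ λ a → a ∈ A₁ × BipGraph.E G a y ≡ false))
lemma2 G connected p5-free _ A₁ B₁ (maximal , _) =
  (λ x x∉A₁ → ∉ˡ⇒neighbours⊆ʳ G maximal connected p5-free x∉A₁
            , ∉ˡ⇒∃-non-neighbour G maximal x∉A₁)
  , (λ y y∉B₁ → ∉ʳ⇒neighbours⊆ˡ G maximal connected p5-free y∉B₁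
              , ∉ʳ⇒∃-non-neighbour G maximal y∉B₁)
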